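{- Let $\mathcal M$ be a unichain Markov decision process with finite state space $S$ and finite action set $A$, and let $\pi_1^{\circ},\pi_2^{\circ}$ be optimal (stationary) policies on $\mathcal M$. Then any combination $\pi$ of these policies, i.e. any policy $\pi:S\to A$ such that for each state $i\in S$ either $\pi(i)=\pi_1^\circ (i)$ or $\pi(i)=\pi_2^\circ (i)$, is optimal as well.
   Context: A Markov decision process (MDP) $\mathcal M$ on a finite state set $S$ with a finite action set $A$ (available in every state) consists of an initial distribution $\mu_0$ on $S$, transition probabilities $p_a(i,j)$ (probability of moving to $j$ when choosing action $a$ in state $i$), and reward distributions with mean $r_a(i)$ for choosing action $a$ in state $i$. A (stationary) policy is a map $\pi:S\to A$; it induces a Markov chain with transition matrix $P=(p_{\pi(i)}(i,j))_{i,j\in S}$. $\mathcal M$ is unichain if for every policy $\pi$ this matrix is irreducible; then it has a unique invariant, strictly positive distribution $\mu$. The average reward of $\pi$ is $V(\pi)=\sum_{i\in S}\mu(i)r_{\pi(i)}(i)$. A policy $\pi^\circ$ is optimal if $V(\pi)\le V(\pi^\circ)$ for all policies $\pi$. -}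

module Defs where

open import Level using (0ℓ)
open import Data.Nat using (ℕ; zero; suc)
open import Data.Fin using (Fin; zero; suc)
open import Data.Product using (Σ; ∃; _×_; _,_)
open import Relation.Nullary using (¬_)
open import Relation.Binary using (Rel; IsTotalOrder)
open import Algebra.Bundles using (CommutativeRing)

-- The scalars: an arbitrary ordered field (ℝ being the intended instance;
-- agda-stdlib has no real numbers). Equality is the setoid equality _≈_.
record OrderedField : Set₁ where
  field
    commutativeRing : CommutativeRing 0ℓ 0ℓ
  open CommutativeRing commutativeRing public
  infix 4 _≤_
  field
    _≤_          : Rel Carrier 0ℓ
    isTotalOrder : IsTotalOrder _≈_ _≤_
    0≉1          : ¬ (0# ≈ 1#)
    inverse      : ∀ x → ¬ (x ≈ 0#) → ∃ λ y → x * y ≈ 1#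
    +-monoˡ-≤    : ∀ {x y} z → x ≤ y → x + z ≤ y + z
    *-nonneg     : ∀ {x y} → 0# ≤ x → 0# ≤ y → 0# ≤ x * y

  infix 4 _<_
  _<_ : Rel Carrier 0ℓ
  x < y = (x ≤ y) × ¬ (x ≈ y)

module _ (F : OrderedField) where
  open OrderedField F using (Carrier; _≈_; _+_; _*_; 0#; 1#; _≤_; _<_)

  sumF : ∀ {n} → (Fin n → Carrier) → Carrier
  sumF {zero}  f = 0#
  sumF {suc n} f = f zero + sumF (λ i → f (suc i))

  IsDistribution : ∀ {n} → (Fin n → Carrier) → Set
  IsDistribution μ = (∀ i → 0# ≤ μ i) × (sumF μ ≈ 1#)

  -- Markov decision process with states Fin n and actions Fin m.
  -- Rewards are given through their means r a i (only means enter).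
  record MDP (n m : ℕ) : Set where
    field
      μ₀      : Fin n → Carrier
      μ₀-dist : IsDistribution μ₀
      p       : Fin m → Fin n → Fin n → Carrier
      p-dist  : ∀ a i → IsDistribution (p a i)
      r       : Fin m → Fin n → Carrier

  Policy : ℕ → ℕ → Set
  Policy n m = Fin n → Fin m

  module _ {n m : ℕ} (M : MDP n m) where
    open MDP M

    transMatrix : Policy n m → Fin n → Fin n → Carrier
    transMatrix π i j = p (π i) i j

    data Path (Q : Fin n → Fin n → Carrier) : Fin n → Fin n → Set where
      one  : ∀ {i j}   → 0# < Q i j → Path Q i j
      step : ∀ {i k j} → 0# < Q i k → Path Q k j → Path Q i j

    Irreducible : (Fin n → Fin n → Carrier) → Set
    Irreducible Q = ∀ i j → Path Q i j

    Unichain : Set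
    Unichain = ∀ (π : Policy n m) → Irreducible (transMatrix π)

    IsInvariant : Policy n m → (Fin n → Carrier) → Set
    IsInvariant π μ = IsDistribution μ
                    × (∀ j → sumF (λ i → μ i * transMatrix π i j) ≈ μ j)

    -- Σ_i μ(i) r_{π(i)}(i); equals V(π) when μ is the (unique) invariant distribution
    averageReward : Policy n m → (Fin n → Carrier) → Carrier
    averageReward π μ = sumF (λ i → μ i * r (π i) i)

    Optimal : Policy n m → Set
    Optimal π° = ∀ (π : Policy n m) (μ μ° : Fin n → Carrier)
               → IsInvariant π μ → IsInvariant π° μ°
               → averageReward π μ ≤ averageReward π° μ°

{-# OPTIONS --safe #-}
-- Over any ordered field, the chain of a policy of a unichain MDP has a stationary
-- distribution ν, and the Poisson equation h + g = r + P h is solvable when g is the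
-- ν-average of r; both are constructed by censoring one state at a time.
-- Let g be the gain and h the bias of π₁, and compare at each state the lookahead
-- r_a(i) + Σ_j p_a(i,j) h(j) of an action with h(i) + g. Averaged against the positive
-- stationary distribution of a policy σ, this comparison is the difference between the
-- gains of σ and π₁. The policy playing π₂ where its lookahead is at least h + g and π₁
-- elsewhere thus has equality everywhere, so π₂'s lookahead is at most h + g; as π₂ is
-- optimal too, equality holds. Hence every combination of π₁ and π₂ has lookahead h + g
-- everywhere, and therefore gain g.
module Submission where

open import Defs
open import Data.Nat using (ℕ; zero; suc)
open import Data.Fin using (Fin; zero; suc)
open import Data.Product using (∃; _×_; _,_; proj₁; proj₂)
open import Data.Sum using (_⊎_; inj₁; inj₂)
open import Data.Empty using (⊥-elim)
open import Function using (_∘_)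
open import Relation.Nullary using (¬_)
open import Relation.Binary using (IsTotalOrder; Poset)
open import Relation.Binary.PropositionalEquality as ≡ using (_≡_)
open import Relation.Binary.Construct.Closure.ReflexiveTransitive using (Star; ε; _◅_)
import Algebra.Properties.Ring as RingProperties
import Algebra.Properties.Semiring.Sum as SemiringSum
import Algebra.Solver.Ring.NaturalCoefficients.Default as SemiringSolver
import Relation.Binary.Reasoning.Setoid as SetoidReasoning
import Relation.Binary.Reasoning.PartialOrder as PosetReasoning

module OrderedFieldProperties (F : OrderedField) where
  open OrderedField F hiding (zero)
  open IsTotalOrder isTotalOrder public
    using (total; antisym; ≤-respˡ-≈; ≤-respʳ-≈; isPartialOrder)
    renaming (refl to ≤-refl; trans to ≤-trans; reflexive to ≤-reflexive)
  open RingProperties ring public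
    using ( -‿distribˡ-*; -‿distribʳ-*; -‿involutive; x[y-z]≈xy-xz
          ; //-rightDividesˡ; xyx⁻¹≈y; x∙y⁻¹≈ε⇒x≈y; +-cancelʳ)
  open SemiringSum semiring public
    using (sum; ∑-distrib-+; ∑-comm; *-distribˡ-sum; *-distribʳ-sum; sum-replicate-zero; sum-cong-≋)
  open SemiringSolver commutativeSemiring public using (solve; _:=_; _:+_; _:*_)

  poset : Poset _ _ _
  poset = record { isPartialOrder = isPartialOrder }

  sumF≡sum : ∀ {n} (f : Fin n → Carrier) → sumF F f ≡ sum f
  sumF≡sum {zero}  f = ≡.refl
  sumF≡sum {suc n} f = ≡.cong (f zero +_) (sumF≡sum (f ∘ suc))

  sumF⇒sum : ∀ {n} (f : Fin n → Carrier) {x} → sumF F f ≈ x → sum f ≈ x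
  sumF⇒sum f = trans (reflexive (≡.sym (sumF≡sum f)))

  sum⇒sumF : ∀ {n} (f : Fin n → Carrier) {x} → sum f ≈ x → sumF F f ≈ x
  sum⇒sumF f = trans (reflexive (sumF≡sum f))

  +-mono-≤ : ∀ {x y u v} → x ≤ y → u ≤ v → x + u ≤ y + v
  +-mono-≤ {x} {y} {u} {v} x≤y u≤v =
    ≤-trans (+-monoˡ-≤ u x≤y) (≤-respˡ-≈ (+-comm u y) (≤-respʳ-≈ (+-comm v y) (+-monoˡ-≤ y u≤v)))

  x≤x+y : ∀ {x y} → 0# ≤ y → x ≤ x + y
  x≤x+y {x} 0≤y = ≤-respˡ-≈ (+-identityʳ x) (+-mono-≤ ≤-refl 0≤y)

  y≤x+y : ∀ {x y} → 0# ≤ x → y ≤ x + y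
  y≤x+y {x} {y} 0≤x = ≤-respʳ-≈ (+-comm y x) (x≤x+y 0≤x)

  x+y≤x⇒y≤0 : ∀ {x y} → x + y ≤ x → y ≤ 0#
  x+y≤x⇒y≤0 {x} {y} x+y≤x =
    ≤-respˡ-≈ (xyx⁻¹≈y x y) (≤-respʳ-≈ (-‿inverseʳ x) (+-monoˡ-≤ (- x) x+y≤x))

  x≤y⇒0≤y-x : ∀ {x y} → x ≤ y → 0# ≤ y - x
  x≤y⇒0≤y-x {x} x≤y = ≤-respˡ-≈ (-‿inverseʳ x) (+-monoˡ-≤ (- x) x≤y)

  0≤y-x⇒x≤y : ∀ {x y} → 0# ≤ y - x → x ≤ y
  0≤y-x⇒x≤y {x} {y} 0≤y-x =
    ≤-respˡ-≈ (+-identityˡ x) (≤-respʳ-≈ (//-rightDividesˡ x y) (+-monoˡ-≤ x 0≤y-x))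

  x*x-nonneg : ∀ x → 0# ≤ x * x
  x*x-nonneg x with total 0# x
  ... | inj₁ 0≤x = *-nonneg 0≤x 0≤x
  ... | inj₂ x≤0 = ≤-respʳ-≈ -x*-x≈x*x (*-nonneg 0≤-x 0≤-x)
    where
    0≤-x : 0# ≤ - x
    0≤-x = ≤-respʳ-≈ (+-identityˡ (- x)) (x≤y⇒0≤y-x x≤0)
    -x*-x≈x*x : - x * - x ≈ x * x
    -x*-x≈x*x = trans (sym (-‿distribˡ-* x (- x)))
                  (trans (-‿cong (sym (-‿distribʳ-* x x))) (-‿involutive (x * x)))

  0<1 : 0# < 1#
  0<1 = ≤-respʳ-≈ (*-identityˡ 1#) (x*x-nonneg 1#) , 0≉1

  *-monoˡ-≤-nonneg : ∀ {z x y} → 0# ≤ z → x ≤ y → z * x ≤ z * y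
  *-monoˡ-≤-nonneg {z} {x} {y} 0≤z x≤y =
    0≤y-x⇒x≤y (≤-respʳ-≈ (x[y-z]≈xy-xz z y x) (*-nonneg 0≤z (x≤y⇒0≤y-x x≤y)))

  x*y≈0⇒y≈0 : ∀ {x y} → ¬ x ≈ 0# → x * y ≈ 0# → y ≈ 0#
  x*y≈0⇒y≈0 {x} {y} x≉0 xy≈0 with inverse x x≉0
  ... | x⁻¹ , xx⁻¹≈1 = begin
    y                ≈⟨ *-identityˡ y ⟨
    1# * y           ≈⟨ *-congʳ xx⁻¹≈1 ⟨
    (x * x⁻¹) * y    ≈⟨ solve 3 (λ x x⁻¹ y → (x :* x⁻¹) :* y := x⁻¹ :* (x :* y)) refl x x⁻¹ y ⟩
    x⁻¹ * (x * y)    ≈⟨ *-congˡ xy≈0 ⟩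
    x⁻¹ * 0#         ≈⟨ zeroʳ x⁻¹ ⟩
    0#               ∎
    where open SetoidReasoning setoid

  <-≤-trans : ∀ {x y z} → x < y → y ≤ z → x < z
  <-≤-trans (x≤y , x≉y) y≤z =
    ≤-trans x≤y y≤z , λ x≈z → x≉y (antisym x≤y (≤-respʳ-≈ (sym x≈z) y≤z))

  *-pos : ∀ {x y} → 0# < x → 0# < y → 0# < x * y
  *-pos (0≤x , 0≉x) (0≤y , 0≉y) =
    *-nonneg 0≤x 0≤y , λ 0≈xy → 0≉y (sym (x*y≈0⇒y≈0 (0≉x ∘ sym) (sym 0≈xy)))

  positive-inverse : ∀ {x} → 0# < x → ∃ λ y → 0# < y × x * y ≈ 1#
  positive-inverse {x} (0≤x , 0≉x) with inverse x (0≉x ∘ sym)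
  ... | y , xy≈1 with total 0# y
  ...   | inj₁ 0≤y = y , (0≤y , λ 0≈y → 0≉1 (trans (sym (zeroʳ x)) (trans (*-congˡ 0≈y) xy≈1))) , xy≈1
  ...   | inj₂ y≤0 = ⊥-elim (0≉1 (antisym (proj₁ 0<1) 1≤0))
    where
    1≤0 : 1# ≤ 0#
    1≤0 = ≤-respˡ-≈ xy≈1 (≤-respʳ-≈ (zeroʳ x) (*-monoˡ-≤-nonneg 0≤x y≤0))

  sum-nonneg : ∀ {n} {f : Fin n → Carrier} → (∀ i → 0# ≤ f i) → 0# ≤ sum f
  sum-nonneg {zero}  _   = ≤-refl
  sum-nonneg {suc n} 0≤f = ≤-respˡ-≈ (+-identityʳ 0#) (+-mono-≤ (0≤f zero) (sum-nonneg (0≤f ∘ suc)))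

  term≤sum : ∀ {n} {f : Fin n → Carrier} → (∀ i → 0# ≤ f i) → ∀ k → f k ≤ sum f
  term≤sum 0≤f zero    = x≤x+y (sum-nonneg (0≤f ∘ suc))
  term≤sum 0≤f (suc k) = ≤-trans (term≤sum (0≤f ∘ suc) k) (y≤x+y (0≤f zero))

  sum≤0⇒terms≈0 : ∀ {n} {f : Fin n → Carrier} → (∀ i → 0# ≤ f i) → sum f ≤ 0# → ∀ k → f k ≈ 0#
  sum≤0⇒terms≈0 0≤f sum≤0 k = antisym (≤-trans (term≤sum 0≤f k) sum≤0) (0≤f k)

  weighted-squeeze : ∀ {n} (w x y : Fin n → Carrier) → (∀ i → 0# < w i) → (∀ i → x i ≤ y i)
                   → sum (λ i → w i * y i) ≤ sum (λ i → w i * x i) → ∀ i → x i ≈ y i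
  weighted-squeeze w x y 0<w x≤y Σwy≤Σwx i =
    sym (x∙y⁻¹≈ε⇒x≈y (y i) (x i) (x*y≈0⇒y≈0 (proj₂ (0<w i) ∘ sym) (sum≤0⇒terms≈0 0≤gap Σgap≤0 i)))
    where
    gap : Fin _ → Carrier
    gap i = w i * (y i - x i)
    0≤gap : ∀ i → 0# ≤ gap i
    0≤gap i = *-nonneg (proj₁ (0<w i)) (x≤y⇒0≤y-x (x≤y i))
    wx+gap≈wy : ∀ i → w i * x i + gap i ≈ w i * y i
    wx+gap≈wy i = trans (+-congˡ (x[y-z]≈xy-xz (w i) (y i) (x i)))
                    (trans (+-comm _ _) (//-rightDividesˡ (w i * x i) (w i * y i)))
    Σgap≤0 : sum gap ≤ 0#
    Σgap≤0 = x+y≤x⇒y≤0 (≤-respˡ-≈ (sym (trans (sym (∑-distrib-+ _ gap)) (sum-cong-≋ wx+gap≈wy))) Σwy≤Σwx)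

module MarkovChains (F : OrderedField) where
  open OrderedField F hiding (zero)
  open OrderedFieldProperties F
  open SetoidReasoning setoid

  Matrix : ℕ → Set
  Matrix k = Fin k → Fin k → Carrier

  IsStochastic : ∀ {k} → Matrix k → Set
  IsStochastic Q = (∀ i j → 0# ≤ Q i j) × (∀ i → sum (Q i) ≈ 1#)

  Edge : ∀ {k} → Matrix k → Fin k → Fin k → Set
  Edge Q i j = 0# < Q i j

  StronglyConnected : ∀ {k} → Matrix k → Set
  StronglyConnected Q = ∀ i j → Star (Edge Q) i j

  IsStationary : ∀ {k} → Matrix k → (Fin k → Carrier) → Set
  IsStationary Q ν = ∀ j → sum (λ i → ν i * Q i j) ≈ ν j

  PoissonSolvable : ∀ {k} → Matrix k → (Fin k → Carrier) → Set
  PoissonSolvable {k} Q ν = ∀ (f : Fin k → Carrier) → sum (λ i → ν i * f i) ≈ 0#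
                      → ∃ λ (h : Fin k → Carrier) → ∀ i → h i ≈ f i + sum (λ j → Q i j * h j)

  -- Both parts are built in one induction: solving the Poisson equation through the
  -- censored chain needs that chain's stationary measure for the zero-mean condition.
  record StationaryMeasure {k} (Q : Matrix k) : Set where
    field
      ν          : Fin k → Carrier
      nonneg     : ∀ i → 0# ≤ ν i
      mass-pos   : 0# < sum ν
      stationary : IsStationary Q ν
      poisson    : PoissonSolvable Q ν

  stationary-average : ∀ {k} {Q : Matrix k} {ν} → IsStationary Q ν → ∀ (h : Fin k → Carrier) →
                       sum (λ i → ν i * sum (λ j → Q i j * h j)) ≈ sum (λ j → ν j * h j)
  stationary-average {Q = Q} {ν} ν-stationary h = begin
    sum (λ i → ν i * sum (λ j → Q i j * h j))
      ≈⟨ sum-cong-≋ (λ i → *-distribˡ-sum (ν i) (λ j → Q i j * h j)) ⟩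
    sum (λ i → sum (λ j → ν i * (Q i j * h j)))
      ≈⟨ ∑-comm (λ i j → ν i * (Q i j * h j)) ⟩
    sum (λ j → sum (λ i → ν i * (Q i j * h j)))
      ≈⟨ sum-cong-≋ (λ j → sum-cong-≋ (λ i → sym (*-assoc (ν i) (Q i j) (h j)))) ⟩
    sum (λ j → sum (λ i → ν i * Q i j * h j))
      ≈⟨ sum-cong-≋ (λ j → sym (*-distribʳ-sum (h j) (λ i → ν i * Q i j))) ⟩
    sum (λ j → sum (λ i → ν i * Q i j) * h j)
      ≈⟨ sum-cong-≋ (λ j → *-congʳ (ν-stationary j)) ⟩
    sum (λ j → ν j * h j)
      ∎

  singleton-stationary : (Q : Matrix 1) → IsStochastic Q → StationaryMeasure Q
  singleton-stationary Q (_ , row-sum) = record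
    { ν          = λ _ → 1#
    ; nonneg     = λ _ → proj₁ 0<1
    ; mass-pos   = <-≤-trans 0<1 (≤-reflexive (sym (+-identityʳ 1#)))
    ; stationary = λ { zero → trans (+-congʳ (*-identityˡ (Q zero zero))) (row-sum zero) }
    ; poisson    = λ f 1*f≈0 → (λ _ → 0#) , λ { zero → sym (begin
        f zero + (Q zero zero * 0# + 0#)  ≈⟨ +-congˡ (trans (+-identityʳ _) (zeroʳ _)) ⟩
        f zero + 0#                       ≈⟨ +-congʳ (*-identityˡ (f zero)) ⟨
        1# * f zero + 0#                  ≈⟨ 1*f≈0 ⟩
        0#                                ∎) }
    }

  module Censoring {n} (Q : Matrix (suc (suc n))) (Q-stochastic : IsStochastic Q)
                   (Q-connected : StronglyConnected Q) where

    private
      0≤Q : ∀ i j → 0# ≤ Q i j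
      0≤Q = proj₁ Q-stochastic
      row-sum : ∀ i → sum (Q i) ≈ 1#
      row-sum = proj₂ Q-stochastic

    escape : Carrier
    escape = sum (λ j → Q zero (suc j))

    first-exit : ∀ {j} → Star (Edge Q) zero (suc j) → ∃ λ k → Edge Q zero (suc k)
    first-exit (_◅_ {j = zero}  _ path) = first-exit path
    first-exit (_◅_ {j = suc k} e _)    = k , e

    0<escape : 0# < escape
    0<escape with first-exit (Q-connected zero (suc zero))
    ... | k , e = <-≤-trans e (term≤sum (λ j → 0≤Q zero (suc j)) k)

    sojourn : Carrier
    sojourn = proj₁ (positive-inverse 0<escape)

    0<sojourn : 0# < sojourn
    0<sojourn = proj₁ (proj₂ (positive-inverse 0<escape))

    escape*sojourn≈1 : escape * sojourn ≈ 1#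
    escape*sojourn≈1 = proj₂ (proj₂ (positive-inverse 0<escape))

    reentry : Fin (suc n) → Carrier
    reentry j = Q zero (suc j) * sojourn

    0≤reentry : ∀ j → 0# ≤ reentry j
    0≤reentry j = *-nonneg (0≤Q zero (suc j)) (proj₁ 0<sojourn)

    sum-reentry : sum reentry ≈ 1#
    sum-reentry = trans (sym (*-distribʳ-sum sojourn (λ j → Q zero (suc j)))) escape*sojourn≈1

    -- The chain watched only while it is outside 0: an excursion through 0
    -- leaves it towards suc j with probability Q 0 (suc j) / (1 - Q 0 0).
    Q′ : Matrix (suc n)
    Q′ i j = Q (suc i) (suc j) + Q (suc i) zero * reentry j

    Q′-stochastic : IsStochastic Q′
    Q′-stochastic = 0≤Q′ , row-sum′
      where
      0≤Q′ : ∀ i j → 0# ≤ Q′ i j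
      0≤Q′ i j = ≤-trans (0≤Q (suc i) (suc j)) (x≤x+y (*-nonneg (0≤Q (suc i) zero) (0≤reentry j)))
      row-sum′ : ∀ i → sum (Q′ i) ≈ 1#
      row-sum′ i = begin
        sum (Q′ i)
          ≈⟨ ∑-distrib-+ (λ j → Q (suc i) (suc j)) (λ j → Q (suc i) zero * reentry j) ⟩
        sum (λ j → Q (suc i) (suc j)) + sum (λ j → Q (suc i) zero * reentry j)
          ≈⟨ +-congˡ (*-distribˡ-sum (Q (suc i) zero) reentry) ⟨
        sum (λ j → Q (suc i) (suc j)) + Q (suc i) zero * sum reentry
          ≈⟨ +-congˡ (trans (*-congˡ sum-reentry) (*-identityʳ _)) ⟩
        sum (λ j → Q (suc i) (suc j)) + Q (suc i) zero
          ≈⟨ +-comm _ _ ⟩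
        sum (Q (suc i))
          ≈⟨ row-sum (suc i) ⟩
        1#
          ∎

    direct-edge : ∀ {i j} → Edge Q (suc i) (suc j) → Edge Q′ i j
    direct-edge {i} {j} e = <-≤-trans e (x≤x+y (*-nonneg (0≤Q (suc i) zero) (0≤reentry j)))

    detour-edge : ∀ {i j} → Edge Q (suc i) zero → Edge Q zero (suc j) → Edge Q′ i j
    detour-edge {i} {j} e e′ = <-≤-trans (*-pos e (*-pos e′ 0<sojourn)) (y≤x+y (0≤Q (suc i) (suc j)))

    mutual
      censor : ∀ {i j} → Star (Edge Q) (suc i) (suc j) → Star (Edge Q′) i j
      censor ε                        = ε
      censor (_◅_ {j = zero}  e path) = censor-detour e path
      censor (_◅_ {j = suc k} e path) = direct-edge e ◅ censor path

      censor-detour : ∀ {i j} → Edge Q (suc i) zero → Star (Edge Q) zero (suc j) → Star (Edge Q′) i j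
      censor-detour e (_◅_ {j = zero}  _  path) = censor-detour e path
      censor-detour e (_◅_ {j = suc k} e′ path) = detour-edge e e′ ◅ censor path

    Q′-connected : StronglyConnected Q′
    Q′-connected i j = censor (Q-connected (suc i) (suc j))

    module Lift (S′ : StationaryMeasure Q′) where
      open StationaryMeasure S′ renaming
        (ν to ν′; nonneg to 0≤ν′; mass-pos to ν′-mass-pos; stationary to ν′-stationary; poisson to ν′-poisson)

      inflow : Carrier
      inflow = sum (λ i → ν′ i * Q (suc i) zero)

      -- Balance at 0: the mass at 0 times its escape probability equals the inflow.
      ν : Fin (suc (suc n)) → Carrier
      ν zero    = inflow * sojourn
      ν (suc i) = ν′ i

      0≤ν : ∀ i → 0# ≤ ν i
      0≤ν zero    = *-nonneg (sum-nonneg (λ i → *-nonneg (0≤ν′ i) (0≤Q (suc i) zero))) (proj₁ 0<sojourn)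
      0≤ν (suc i) = 0≤ν′ i

      ν-mass-pos : 0# < sum ν
      ν-mass-pos = <-≤-trans ν′-mass-pos (y≤x+y (0≤ν zero))

      ν-stationary : IsStationary Q ν
      ν-stationary zero = begin
        ν zero * Q zero zero + inflow            ≈⟨ +-congˡ inflow≈ν₀*escape ⟩
        ν zero * Q zero zero + ν zero * escape   ≈⟨ distribˡ (ν zero) (Q zero zero) escape ⟨
        ν zero * (Q zero zero + escape)          ≈⟨ *-congˡ (row-sum zero) ⟩
        ν zero * 1#                              ≈⟨ *-identityʳ (ν zero) ⟩
        ν zero                                   ∎
        where
        inflow≈ν₀*escape : inflow ≈ ν zero * escape
        inflow≈ν₀*escape = begin
          inflow                          ≈⟨ *-identityʳ inflow ⟨
          inflow * 1#                     ≈⟨ *-congˡ escape*sojourn≈1 ⟨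
          inflow * (escape * sojourn)     ≈⟨ solve 3 (λ a e s → a :* (e :* s) := a :* s :* e) refl inflow escape sojourn ⟩
          inflow * sojourn * escape       ∎
      ν-stationary (suc j) = begin
        ν zero * Q zero (suc j) + sum (λ i → ν′ i * Q (suc i) (suc j))
          ≈⟨ +-comm _ _ ⟩
        sum (λ i → ν′ i * Q (suc i) (suc j)) + ν zero * Q zero (suc j)
          ≈⟨ +-congˡ (solve 3 (λ a s q → a :* s :* q := a :* (q :* s)) refl inflow sojourn (Q zero (suc j))) ⟩
        sum (λ i → ν′ i * Q (suc i) (suc j)) + inflow * reentry j
          ≈⟨ +-congˡ (*-distribʳ-sum (reentry j) (λ i → ν′ i * Q (suc i) zero)) ⟩
        sum (λ i → ν′ i * Q (suc i) (suc j)) + sum (λ i → ν′ i * Q (suc i) zero * reentry j)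
          ≈⟨ ∑-distrib-+ (λ i → ν′ i * Q (suc i) (suc j)) (λ i → ν′ i * Q (suc i) zero * reentry j) ⟨
        sum (λ i → ν′ i * Q (suc i) (suc j) + ν′ i * Q (suc i) zero * reentry j)
          ≈⟨ sum-cong-≋ (λ i → solve 4 (λ v q a r → v :* (q :+ a :* r) := v :* q :+ v :* a :* r) refl
                                   (ν′ i) (Q (suc i) (suc j)) (Q (suc i) zero) (reentry j)) ⟨
        sum (λ i → ν′ i * Q′ i j)
          ≈⟨ ν′-stationary j ⟩
        ν′ j
          ∎

      module Poisson (f : Fin (suc (suc n)) → Carrier) (Σνf≈0 : sum (λ i → ν i * f i) ≈ 0#) where

        -- The reward f 0 of the 1 / (1 - Q 0 0) expected visits to 0 is charged to the step into 0.
        f′ : Fin (suc n) → Carrier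
        f′ i = f (suc i) + Q (suc i) zero * (f zero * sojourn)

        Σν′f′≈0 : sum (λ i → ν′ i * f′ i) ≈ 0#
        Σν′f′≈0 = begin
          sum (λ i → ν′ i * f′ i)
            ≈⟨ sum-cong-≋ (λ i → solve 4 (λ v x a y → v :* (x :+ a :* y) := v :* x :+ v :* a :* y) refl
                                     (ν′ i) (f (suc i)) (Q (suc i) zero) (f zero * sojourn)) ⟩
          sum (λ i → ν′ i * f (suc i) + ν′ i * Q (suc i) zero * (f zero * sojourn))
            ≈⟨ ∑-distrib-+ (λ i → ν′ i * f (suc i)) (λ i → ν′ i * Q (suc i) zero * (f zero * sojourn)) ⟩
          sum (λ i → ν′ i * f (suc i)) + sum (λ i → ν′ i * Q (suc i) zero * (f zero * sojourn))
            ≈⟨ +-congˡ (*-distribʳ-sum (f zero * sojourn) (λ i → ν′ i * Q (suc i) zero)) ⟨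
          sum (λ i → ν′ i * f (suc i)) + inflow * (f zero * sojourn)
            ≈⟨ solve 4 (λ S a x s → S :+ a :* (x :* s) := a :* s :* x :+ S) refl _ inflow (f zero) sojourn ⟩
          ν zero * f zero + sum (λ i → ν′ i * f (suc i))
            ≈⟨ Σνf≈0 ⟩
          0#
            ∎

        h′ : Fin (suc n) → Carrier
        h′ = proj₁ (ν′-poisson f′ Σν′f′≈0)

        h′-poisson : ∀ i → h′ i ≈ f′ i + sum (λ j → Q′ i j * h′ j)
        h′-poisson = proj₂ (ν′-poisson f′ Σν′f′≈0)

        reentry-value : Carrier
        reentry-value = sum (λ j → Q zero (suc j) * h′ j)

        -- Row 0 of the Poisson equation reads (1 - Q 0 0) h 0 = f 0 + reentry-value.
        h : Fin (suc (suc n)) → Carrier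
        h zero    = (f zero + reentry-value) * sojourn
        h (suc i) = h′ i

        Q′-apply : ∀ i → sum (λ j → Q′ i j * h′ j)
                       ≈ sum (λ j → Q (suc i) (suc j) * h′ j) + Q (suc i) zero * sojourn * reentry-value
        Q′-apply i = begin
          sum (λ j → Q′ i j * h′ j)
            ≈⟨ sum-cong-≋ (λ j → solve 5 (λ q a x s y → (q :+ a :* (x :* s)) :* y := q :* y :+ a :* s :* (x :* y)) refl
                                     (Q (suc i) (suc j)) (Q (suc i) zero) (Q zero (suc j)) sojourn (h′ j)) ⟩
          sum (λ j → Q (suc i) (suc j) * h′ j + Q (suc i) zero * sojourn * (Q zero (suc j) * h′ j))
            ≈⟨ ∑-distrib-+ (λ j → Q (suc i) (suc j) * h′ j) (λ j → Q (suc i) zero * sojourn * (Q zero (suc j) * h′ j)) ⟩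
          sum (λ j → Q (suc i) (suc j) * h′ j) + sum (λ j → Q (suc i) zero * sojourn * (Q zero (suc j) * h′ j))
            ≈⟨ +-congˡ (*-distribˡ-sum (Q (suc i) zero * sojourn) (λ j → Q zero (suc j) * h′ j)) ⟨
          sum (λ j → Q (suc i) (suc j) * h′ j) + Q (suc i) zero * sojourn * reentry-value
            ∎

        h-poisson : ∀ i → h i ≈ f i + sum (λ j → Q i j * h j)
        h-poisson zero = begin
          h zero
            ≈⟨ *-identityʳ (h zero) ⟨
          h zero * 1#
            ≈⟨ *-congˡ (row-sum zero) ⟨
          h zero * (Q zero zero + escape)
            ≈⟨ solve 5 (λ x r s q e → (x :+ r) :* s :* (q :+ e) := (x :+ r) :* (e :* s) :+ q :* ((x :+ r) :* s)) refl
                       (f zero) reentry-value sojourn (Q zero zero) escape ⟩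
          (f zero + reentry-value) * (escape * sojourn) + Q zero zero * h zero
            ≈⟨ +-congʳ (trans (*-congˡ escape*sojourn≈1) (*-identityʳ _)) ⟩
          f zero + reentry-value + Q zero zero * h zero
            ≈⟨ solve 3 (λ x r y → x :+ r :+ y := x :+ (y :+ r)) refl (f zero) reentry-value (Q zero zero * h zero) ⟩
          f zero + (Q zero zero * h zero + reentry-value)
            ∎
        h-poisson (suc i) = begin
          h′ i
            ≈⟨ h′-poisson i ⟩
          f′ i + sum (λ j → Q′ i j * h′ j)
            ≈⟨ +-congˡ (Q′-apply i) ⟩
          f′ i + (sum (λ j → Q (suc i) (suc j) * h′ j) + Q (suc i) zero * sojourn * reentry-value)
            ≈⟨ solve 6 (λ y a x s R r → y :+ a :* (x :* s) :+ (R :+ a :* s :* r) := y :+ (a :* ((x :+ r) :* s) :+ R)) refl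
                       (f (suc i)) (Q (suc i) zero) (f zero) sojourn (sum (λ j → Q (suc i) (suc j) * h′ j)) reentry-value ⟩
          f (suc i) + (Q (suc i) zero * h zero + sum (λ j → Q (suc i) (suc j) * h′ j))
            ∎

      measure : StationaryMeasure Q
      measure = record
        { ν          = ν
        ; nonneg     = 0≤ν
        ; mass-pos   = ν-mass-pos
        ; stationary = ν-stationary
        ; poisson    = λ f Σνf≈0 → Poisson.h f Σνf≈0 , Poisson.h-poisson f Σνf≈0
        }

  stationaryMeasure : ∀ {n} (Q : Matrix (suc n)) → IsStochastic Q → StronglyConnected Q → StationaryMeasure Q
  stationaryMeasure {zero}  Q Q-stochastic _           = singleton-stationary Q Q-stochastic
  stationaryMeasure {suc n} Q Q-stochastic Q-connected =
    Lift.measure (stationaryMeasure Q′ Q′-stochastic Q′-connected)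
    where open Censoring Q Q-stochastic Q-connected

  module Normalise {k} {Q : Matrix k} (S : StationaryMeasure Q) where
    open StationaryMeasure S

    mass⁻¹ : Carrier
    mass⁻¹ = proj₁ (positive-inverse mass-pos)

    0<mass⁻¹ : 0# < mass⁻¹
    0<mass⁻¹ = proj₁ (proj₂ (positive-inverse mass-pos))

    mass*mass⁻¹≈1 : sum ν * mass⁻¹ ≈ 1#
    mass*mass⁻¹≈1 = proj₂ (proj₂ (positive-inverse mass-pos))

    sum-rescale : ∀ (g : Fin k → Carrier) → sum (λ i → mass⁻¹ * ν i * g i) ≈ mass⁻¹ * sum (λ i → ν i * g i)
    sum-rescale g = trans (sum-cong-≋ (λ i → *-assoc mass⁻¹ (ν i) (g i))) (sym (*-distribˡ-sum mass⁻¹ (λ i → ν i * g i)))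

    mass≈1 : sum (λ i → mass⁻¹ * ν i) ≈ 1#
    mass≈1 = trans (sym (*-distribˡ-sum mass⁻¹ ν)) (trans (*-comm mass⁻¹ (sum ν)) mass*mass⁻¹≈1)

    measure : StationaryMeasure Q
    measure = record
      { ν          = λ i → mass⁻¹ * ν i
      ; nonneg     = λ i → *-nonneg (proj₁ 0<mass⁻¹) (nonneg i)
      ; mass-pos   = <-≤-trans 0<1 (≤-reflexive (sym mass≈1))
      ; stationary = λ j → trans (sum-rescale (λ i → Q i j)) (*-congˡ (stationary j))
      ; poisson    = λ f Σν′f≈0 →
          poisson f (x*y≈0⇒y≈0 (proj₂ 0<mass⁻¹ ∘ sym) (trans (sym (sum-rescale f)) Σν′f≈0))
      }

  vanishes-upstream : ∀ {k} {Q : Matrix k} {ν} → (∀ i j → 0# ≤ Q i j) → (∀ i → 0# ≤ ν i) → IsStationary Q ν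
                    → ∀ {i j} → Star (Edge Q) i j → ν j ≈ 0# → ν i ≈ 0#
  vanishes-upstream _ _ _ ε νj≈0 = νj≈0
  vanishes-upstream {Q = Q} {ν} 0≤Q 0≤ν ν-stationary {i} (_◅_ {j = k} e path) νj≈0 =
    x*y≈0⇒y≈0 (proj₂ e ∘ sym) (trans (*-comm (Q i k) (ν i)) (sum≤0⇒terms≈0 0≤flow flow≤0 i))
    where
    0≤flow : ∀ l → 0# ≤ ν l * Q l k
    0≤flow l = *-nonneg (0≤ν l) (0≤Q l k)
    flow≤0 : sum (λ l → ν l * Q l k) ≤ 0#
    flow≤0 = ≤-reflexive (trans (ν-stationary k) (vanishes-upstream 0≤Q 0≤ν ν-stationary path νj≈0))

  stationary-positive : ∀ {k} {Q : Matrix k} {ν} → (∀ i j → 0# ≤ Q i j) → StronglyConnected Q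
                      → (∀ i → 0# ≤ ν i) → IsStationary Q ν → ¬ sum ν ≈ 0# → ∀ i → 0# < ν i
  stationary-positive {k} 0≤Q Q-connected 0≤ν ν-stationary mass≉0 i = 0≤ν i , λ 0≈νi →
    mass≉0 (trans (sum-cong-≋ (λ l → vanishes-upstream 0≤Q 0≤ν ν-stationary (Q-connected l i) (sym 0≈νi)))
                  (sum-replicate-zero k))

module PolicyChains (F : OrderedField) {n m : ℕ} (M : MDP F n m) where
  open OrderedField F hiding (zero)
  open OrderedFieldProperties F
  open MarkovChains F
  open MDP M

  P : Policy F n m → Matrix n
  P = transMatrix F M

  distribution-mass : ∀ {μ : Fin n → Carrier} → IsDistribution F μ → sum μ ≈ 1#
  distribution-mass {μ} (_ , mass≈1) = sumF⇒sum μ mass≈1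

  policy-stochastic : ∀ σ → IsStochastic (P σ)
  policy-stochastic σ = (λ i → proj₁ (p-dist (σ i) i)) , (λ i → distribution-mass (p-dist (σ i) i))

  path⇒star : ∀ {Q i j} → Path F M Q i j → Star (Edge Q) i j
  path⇒star (one e)       = e ◅ ε
  path⇒star (step e path) = e ◅ path⇒star path

  unichain-connected : Unichain F M → ∀ σ → StronglyConnected (P σ)
  unichain-connected unichain σ i j = path⇒star (unichain σ i j)

  invariant-stationary : ∀ {σ μ} → IsInvariant F M σ μ → IsStationary (P σ) μ
  invariant-stationary {σ} {μ} (_ , μ-invariant) j = sumF⇒sum (λ i → μ i * P σ i j) (μ-invariant j)

  stationary-invariant : ∀ {σ μ} → (∀ i → 0# ≤ μ i) → sum μ ≈ 1# → IsStationary (P σ) μ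
                       → IsInvariant F M σ μ
  stationary-invariant {σ} {μ} 0≤μ mass≈1 μ-stationary =
    (0≤μ , sum⇒sumF μ mass≈1) , λ j → sum⇒sumF (λ i → μ i * P σ i j) (μ-stationary j)

  invariant-positive : Unichain F M → ∀ {σ μ} → IsInvariant F M σ μ → ∀ i → 0# < μ i
  invariant-positive unichain {σ} μ-inv@(μ-dist@(0≤μ , _) , _) =
    stationary-positive (proj₁ (policy-stochastic σ)) (unichain-connected unichain σ) 0≤μ
      (invariant-stationary μ-inv) (λ mass≈0 → 0≉1 (trans (sym mass≈0) (distribution-mass μ-dist)))

module Combination (F : OrderedField) {n m : ℕ} (M : MDP F (suc n) m) (unichain : Unichain F M)
                   (π₁ π₂ : Policy F (suc n) m)
                   (π₁-optimal : Optimal F M π₁) (π₂-optimal : Optimal F M π₂) where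
  open OrderedField F hiding (zero)
  open OrderedFieldProperties F
  open MarkovChains F
  open PolicyChains F M
  open MDP M

  module Stationary (σ : Policy F (suc n) m) =
    Normalise (stationaryMeasure (P σ) (policy-stochastic σ) (unichain-connected unichain σ))

  ν : Policy F (suc n) m → Fin (suc n) → Carrier
  ν σ = StationaryMeasure.ν (Stationary.measure σ)

  ν-invariant : ∀ σ → IsInvariant F M σ (ν σ)
  ν-invariant σ = stationary-invariant {σ = σ} (StationaryMeasure.nonneg (Stationary.measure σ))
                    (Stationary.mass≈1 σ) (StationaryMeasure.stationary (Stationary.measure σ))

  g : Carrier
  g = averageReward F M π₁ (ν π₁)

  Σν₁[r-g]≈0 : sum (λ i → ν π₁ i * (r (π₁ i) i - g)) ≈ 0#
  Σν₁[r-g]≈0 = begin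
    sum (λ i → ν π₁ i * (r (π₁ i) i - g))
      ≈⟨ sum-cong-≋ (λ i → distribˡ (ν π₁ i) (r (π₁ i) i) (- g)) ⟩
    sum (λ i → ν π₁ i * r (π₁ i) i + ν π₁ i * - g)
      ≈⟨ ∑-distrib-+ (λ i → ν π₁ i * r (π₁ i) i) (λ i → ν π₁ i * - g) ⟩
    sum (λ i → ν π₁ i * r (π₁ i) i) + sum (λ i → ν π₁ i * - g)
      ≈⟨ +-cong (reflexive (sumF≡sum (λ i → ν π₁ i * r (π₁ i) i))) (*-distribʳ-sum (- g) (ν π₁)) ⟨
    g + sum (ν π₁) * - g
      ≈⟨ +-congˡ (trans (*-congʳ (Stationary.mass≈1 π₁)) (*-identityˡ (- g))) ⟩
    g - g
      ≈⟨ -‿inverseʳ g ⟩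
    0#
      ∎
    where open SetoidReasoning setoid

  bias : ∃ λ (h : Fin (suc n) → Carrier) → ∀ i → h i ≈ (r (π₁ i) i - g) + sum (λ j → p (π₁ i) i j * h j)
  bias = StationaryMeasure.poisson (Stationary.measure π₁) (λ i → r (π₁ i) i - g) Σν₁[r-g]≈0

  h : Fin (suc n) → Carrier
  h = proj₁ bias

  lookahead : Fin (suc n) → Fin m → Carrier
  lookahead i a = r a i + sum (λ j → p a i j * h j)

  π₁-lookahead : ∀ i → lookahead i (π₁ i) ≈ h i + g
  π₁-lookahead i = sym (begin
    h i + g                                          ≈⟨ +-congʳ (proj₂ bias i) ⟩
    r (π₁ i) i - g + sum (λ j → p (π₁ i) i j * h j) + g
      ≈⟨ solve 4 (λ x y u v → x :+ y :+ u :+ v := x :+ u :+ (y :+ v)) refl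
                 (r (π₁ i) i) (- g) (sum (λ j → p (π₁ i) i j * h j)) g ⟩
    lookahead i (π₁ i) + (- g + g)                   ≈⟨ +-congˡ (-‿inverseˡ g) ⟩
    lookahead i (π₁ i) + 0#                          ≈⟨ +-identityʳ _ ⟩
    lookahead i (π₁ i)                               ∎)
    where open SetoidReasoning setoid

  average-lookahead : ∀ σ {μ} → IsInvariant F M σ μ →
                      sum (λ i → μ i * lookahead i (σ i)) ≈ averageReward F M σ μ + sum (λ i → μ i * h i)
  average-lookahead σ {μ} μ-invariant = begin
    sum (λ i → μ i * lookahead i (σ i))
      ≈⟨ sum-cong-≋ (λ i → distribˡ (μ i) (r (σ i) i) (sum (λ j → P σ i j * h j))) ⟩
    sum (λ i → μ i * r (σ i) i + μ i * sum (λ j → P σ i j * h j))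
      ≈⟨ ∑-distrib-+ (λ i → μ i * r (σ i) i) (λ i → μ i * sum (λ j → P σ i j * h j)) ⟩
    sum (λ i → μ i * r (σ i) i) + sum (λ i → μ i * sum (λ j → P σ i j * h j))
      ≈⟨ +-cong (reflexive (≡.sym (sumF≡sum (λ i → μ i * r (σ i) i))))
                (stationary-average {Q = P σ} (invariant-stationary {σ} μ-invariant) h) ⟩
    averageReward F M σ μ + sum (λ i → μ i * h i)
      ∎
    where open SetoidReasoning setoid

  average-bias : ∀ {μ} → IsDistribution F μ → sum (λ i → μ i * (h i + g)) ≈ sum (λ i → μ i * h i) + g
  average-bias {μ} μ-dist = begin
    sum (λ i → μ i * (h i + g))                ≈⟨ sum-cong-≋ (λ i → distribˡ (μ i) (h i) g) ⟩
    sum (λ i → μ i * h i + μ i * g)            ≈⟨ ∑-distrib-+ (λ i → μ i * h i) (λ i → μ i * g) ⟩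
    sum (λ i → μ i * h i) + sum (λ i → μ i * g) ≈⟨ +-congˡ (*-distribʳ-sum g μ) ⟨
    sum (λ i → μ i * h i) + sum μ * g          ≈⟨ +-congˡ (trans (*-congʳ (distribution-mass μ-dist)) (*-identityˡ g)) ⟩
    sum (λ i → μ i * h i) + g                  ∎
    where open SetoidReasoning setoid

  lookahead-average-≤ : ∀ σ → averageReward F M σ (ν σ) ≤ g →
                        sum (λ i → ν σ i * lookahead i (σ i)) ≤ sum (λ i → ν σ i * (h i + g))
  lookahead-average-≤ σ Vσ≤g = begin
    sum (λ i → ν σ i * lookahead i (σ i))                ≈⟨ average-lookahead σ (ν-invariant σ) ⟩
    averageReward F M σ (ν σ) + sum (λ i → ν σ i * h i)  ≤⟨ +-monoˡ-≤ _ Vσ≤g ⟩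
    g + sum (λ i → ν σ i * h i)                          ≈⟨ +-comm g _ ⟩
    sum (λ i → ν σ i * h i) + g                          ≈⟨ average-bias (proj₁ (ν-invariant σ)) ⟨
    sum (λ i → ν σ i * (h i + g))                        ∎
    where open PosetReasoning poset

  bias-average-≤ : ∀ σ → g ≤ averageReward F M σ (ν σ) →
                   sum (λ i → ν σ i * (h i + g)) ≤ sum (λ i → ν σ i * lookahead i (σ i))
  bias-average-≤ σ g≤Vσ = begin
    sum (λ i → ν σ i * (h i + g))                        ≈⟨ average-bias (proj₁ (ν-invariant σ)) ⟩
    sum (λ i → ν σ i * h i) + g                          ≈⟨ +-comm _ g ⟩
    g + sum (λ i → ν σ i * h i)                          ≤⟨ +-monoˡ-≤ _ g≤Vσ ⟩
    averageReward F M σ (ν σ) + sum (λ i → ν σ i * h i)  ≈⟨ average-lookahead σ (ν-invariant σ) ⟨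
    sum (λ i → ν σ i * lookahead i (σ i))                ∎
    where open PosetReasoning poset

  improving⇒lookahead≈ : ∀ σ → (∀ i → h i + g ≤ lookahead i (σ i)) → ∀ i → h i + g ≈ lookahead i (σ i)
  improving⇒lookahead≈ σ improving =
    weighted-squeeze (ν σ) (λ i → h i + g) (λ i → lookahead i (σ i)) (invariant-positive unichain {σ} (ν-invariant σ))
      improving (lookahead-average-≤ σ (π₁-optimal σ (ν σ) (ν π₁) (ν-invariant σ) (ν-invariant π₁)))

  optimal⇒lookahead≈ : ∀ σ → Optimal F M σ → (∀ i → lookahead i (σ i) ≤ h i + g)
                     → ∀ i → lookahead i (σ i) ≈ h i + g
  optimal⇒lookahead≈ σ σ-optimal worsening =
    weighted-squeeze (ν σ) (λ i → lookahead i (σ i)) (λ i → h i + g) (invariant-positive unichain {σ} (ν-invariant σ))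
      worsening (bias-average-≤ σ (σ-optimal π₁ (ν π₁) (ν σ) (ν-invariant π₁) (ν-invariant σ)))

  Comparison : Fin (suc n) → Set
  Comparison i = (h i + g ≤ lookahead i (π₂ i)) ⊎ (lookahead i (π₂ i) ≤ h i + g)

  choose : ∀ i → Comparison i → Fin m
  choose i (inj₁ _) = π₂ i
  choose i (inj₂ _) = π₁ i

  choose-improving : ∀ i d → h i + g ≤ lookahead i (choose i d)
  choose-improving i (inj₁ ≤π₂) = ≤π₂
  choose-improving i (inj₂ _)   = ≤-reflexive (sym (π₁-lookahead i))

  switch : Policy F (suc n) m
  switch i = choose i (total (h i + g) (lookahead i (π₂ i)))

  switch-improving : ∀ i → h i + g ≤ lookahead i (switch i)
  switch-improving i = choose-improving i (total (h i + g) (lookahead i (π₂ i)))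

  π₂-lookahead-≤ : ∀ i → lookahead i (π₂ i) ≤ h i + g
  π₂-lookahead-≤ i = chosen-≈⇒π₂-≤ (total (h i + g) (lookahead i (π₂ i)))
                       (improving⇒lookahead≈ switch switch-improving i)
    where
    chosen-≈⇒π₂-≤ : ∀ d → h i + g ≈ lookahead i (choose i d) → lookahead i (π₂ i) ≤ h i + g
    chosen-≈⇒π₂-≤ (inj₁ _)   ≈π₂ = ≤-reflexive (sym ≈π₂)
    chosen-≈⇒π₂-≤ (inj₂ ≥π₂) _   = ≥π₂

  π₂-lookahead : ∀ i → lookahead i (π₂ i) ≈ h i + g
  π₂-lookahead = optimal⇒lookahead≈ π₂ π₂-optimal π₂-lookahead-≤

  combination-lookahead : ∀ i a → (a ≡ π₁ i) ⊎ (a ≡ π₂ i) → lookahead i a ≈ h i + g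
  combination-lookahead i _ (inj₁ ≡.refl) = π₁-lookahead i
  combination-lookahead i _ (inj₂ ≡.refl) = π₂-lookahead i

  balanced⇒gain≈g : ∀ σ {μ} → (∀ i → lookahead i (σ i) ≈ h i + g) → IsInvariant F M σ μ
                  → averageReward F M σ μ ≈ g
  balanced⇒gain≈g σ {μ} balanced μ-invariant = +-cancelʳ (sum (λ i → μ i * h i)) _ _ (begin
    averageReward F M σ μ + sum (λ i → μ i * h i)   ≈⟨ average-lookahead σ μ-invariant ⟨
    sum (λ i → μ i * lookahead i (σ i))             ≈⟨ sum-cong-≋ (λ i → *-congˡ {x = μ i} (balanced i)) ⟩
    sum (λ i → μ i * (h i + g))                     ≈⟨ average-bias (proj₁ μ-invariant) ⟩
    sum (λ i → μ i * h i) + g                       ≈⟨ +-comm _ g ⟩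
    g + sum (λ i → μ i * h i)                       ∎)
    where open SetoidReasoning setoid

  combination-optimal : ∀ π → (∀ i → (π i ≡ π₁ i) ⊎ (π i ≡ π₂ i)) → Optimal F M π
  combination-optimal π combination π′ μ′ μ μ′-invariant μ-invariant =
    ≤-respʳ-≈ (sym (balanced⇒gain≈g π (λ i → combination-lookahead i (π i) (combination i)) μ-invariant))
      (π₁-optimal π′ μ′ (ν π₁) μ′-invariant (ν-invariant π₁))

theorem1 : (F : OrderedField) {n m : ℕ} (M : MDP F n m)
           → Unichain F M
           → (π₁ π₂ : Policy F n m)
           → Optimal F M π₁ → Optimal F M π₂
           → (π : Policy F n m)
           → (∀ i → (π i ≡ π₁ i) ⊎ (π i ≡ π₂ i))
           → Optimal F M π
-- a distribution on Fin 0 would have mass sumF F μ = 0#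
theorem1 F {zero}  M _ _ _ _ _ _ _ _ _ _ _ μ-invariant =
  ⊥-elim (OrderedField.0≉1 F (proj₂ (proj₁ μ-invariant)))
theorem1 F {suc n} M unichain π₁ π₂ π₁-optimal π₂-optimal =
  Combination.combination-optimal F M unichain π₁ π₂ π₁-optimal π₂-optimal
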